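{- For $n\geq 1$ let $x_{n,1}<\dots<x_{n,n}=0$ be the $n$ (real, distinct) roots of the Eulerian polynomial $A_n(x)=\sum_{k=1}^n A(n,k)x^k$, set $u_{n,k}=\frac{1}{1-x_{n,k}}$, and for $0\leq p\leq n$ let $$e_{n,p}=\sum_{1\leq i_1<\dots<i_p\leq n}u_{n,i_1}\cdots u_{n,i_p},$$ with $e_{n,0}=1$. Then for any $0\leq p\leq n$, $$e_{n,p}=\frac{(n-p)!}{n!}\,S(n+1,n-p+1),$$ where $S(m,j)$ denotes the Stirling number of the second kind.
   Context: For $1\leq k\leq n$, $A(n,k)$ denotes the Eulerian number, i.e. the number of permutations of $\{1,\dots,n\}$ with exactly $k-1$ descents. $A_n$ has $n$ distinct real roots, the largest being $0$. $S(m,j)$ is the number of set partitions of $\{1,\dots,m\}$ into $j$ blocks. -}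

module Defs where

open import Level using (0ℓ)
open import Algebra.Bundles using (CommutativeRing)
open import Data.Nat as ℕ using (ℕ; zero; suc)
open import Data.Fin using (Fin)
import Data.Fin as Fin
open import Data.List as List using (List; []; _∷_; length; filter; concatMap; map; _++_)
open import Data.Product using (Σ; _×_; _,_; ∃)
open import Data.Sum using (_⊎_)
open import Relation.Nullary using (¬_)
open import Relation.Nullary.Decidable using (⌊_⌋)
open import Data.Bool using (Bool; true; false; if_then_else_)

insertions : ℕ → List ℕ → List (List ℕ)
insertions a []       = (a ∷ []) ∷ []
insertions a (b ∷ bs) = (a ∷ b ∷ bs) ∷ map (b ∷_) (insertions a bs)

-- all permutations of the list [1, ..., n]  (one-line notation)
perms : ℕ → List (List ℕ)
perms zero    = [] ∷ []
perms (suc n) = concatMap (insertions (suc n)) (perms n)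

descents : List ℕ → ℕ
descents []             = 0
descents (a ∷ [])       = 0
descents (a ∷ b ∷ rest) = (if ⌊ b ℕ.<? a ⌋ then 1 else 0) ℕ.+ descents (b ∷ rest)

-- Eulerian number A(n,k): number of permutations of {1..n} with exactly k-1 descents
-- (only used for 1 ≤ k ≤ n)
eulerian : ℕ → ℕ → ℕ
eulerian n k = length (filter (λ σ → descents σ ℕ.≟ (k ℕ.∸ 1)) (perms n))

addToBlocks : ℕ → List (List ℕ) → List (List (List ℕ))
addToBlocks a []       = []
addToBlocks a (B ∷ Bs) = ((a ∷ B) ∷ Bs) ∷ map (B ∷_) (addToBlocks a Bs)

setPartitions : ℕ → List (List (List ℕ))
setPartitions zero    = [] ∷ []
setPartitions (suc m) =
  concatMap (λ P → ((suc m ∷ []) ∷ P) ∷ addToBlocks (suc m) P) (setPartitions m)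

stirling2 : ℕ → ℕ → ℕ
stirling2 m j = length (filter (λ P → length P ℕ.≟ j) (setPartitions m))

-- The real numbers, axiomatised as a complete ordered field
-- (any two such are isomorphic, so quantifying over them is faithful).

record RealField : Set₁ where
  field
    commRing : CommutativeRing 0ℓ 0ℓ
  open CommutativeRing commRing public hiding (ring)
  field
    _<_          : Carrier → Carrier → Set
    <-irrefl     : ∀ {x} → ¬ (x < x)
    <-trans      : ∀ {x y z} → x < y → y < z → x < z
    <-trichotomy : ∀ x y → (x < y) ⊎ ((x ≈ y) ⊎ (y < x))
    <-respˡ-≈    : ∀ {x y z} → x ≈ y → x < z → y < z
    <-respʳ-≈    : ∀ {x y z} → x ≈ y → z < x → z < y
    +-mono-<     : ∀ {x y} z → x < y → (x + z) < (y + z)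
    *-pos        : ∀ {x y} → 0# < x → 0# < y → 0# < (x * y)
    0≉1          : ¬ (0# ≈ 1#)
    _⁻¹          : Carrier → Carrier
    ⁻¹-inverse   : ∀ x → ¬ (x ≈ 0#) → (x * (x ⁻¹)) ≈ 1#
    sup          : (P : Carrier → Set) → ∃ P →
                   ∃ (λ b → ∀ y → P y → (y < b ⊎ y ≈ b)) →
                   ∃ (λ s → (∀ y → P y → (y < s ⊎ y ≈ s)) ×
                            (∀ b → (∀ y → P y → (y < b ⊎ y ≈ b)) → (s < b ⊎ s ≈ b)))

module RealOps (R : RealField) where
  open RealField R public

  fromℕ : ℕ → Carrier
  fromℕ zero    = 0#
  fromℕ (suc n) = 1# + fromℕ n

  _^_ : Carrier → ℕ → Carrier
  x ^ zero  = 1#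
  x ^ suc k = x * (x ^ k)

  sum1 : ℕ → (ℕ → Carrier) → Carrier
  sum1 zero    f = 0#
  sum1 (suc m) f = sum1 m f + f (suc m)

  eulerPoly : ℕ → Carrier → Carrier
  eulerPoly n x = sum1 n (λ k → fromℕ (eulerian n k) * (x ^ k))

  -- elementary symmetric polynomial e_p(u_1,...,u_n)
  -- = Σ_{i_1<...<i_p} u_{i_1}...u_{i_p}, computed by splitting on whether
  -- the first variable is chosen.
  esym : ∀ n → (Fin n → Carrier) → ℕ → Carrier
  esym n       u zero    = 1#
  esym zero    u (suc p) = 0#
  esym (suc n) u (suc p) =
    (u Fin.zero * esym n (λ i → u (Fin.suc i)) p) + esym n (λ i → u (Fin.suc i)) (suc p)

-- Since A_n(x) = ∑_σ x^(des σ + 1), the binomial theorem gives A_n(1 + z) = ∑_q c(n,q) z^q with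
-- c(n,q) = ∑_σ C(des σ + 1, q). Inserting n + 1 into the permutations of {1, …, n} shows that c(n,q)
-- satisfies the recurrence of (n - q)! S(n + 1, n - q + 1), hence equals it; so A_n(1 + z) is monic with
-- constant term n!. Its roots are the x_i - 1, so A_n(1 + z) = ∏ (z + 1 - x_i); dividing by the constant
-- term ∏ (1 - x_i) = n! gives ∏ (1 + u_i z) = A_n(1 + z) / n!, and comparing coefficients of z^p ends the proof.

module Submission where

open import Defs
open import Data.Nat using (ℕ; suc; _≤_; _∸_; _!) renaming (_<_ to _<ℕ_)
open import Data.Fin using (Fin; toℕ)

open import Level using (Level)
open import Data.Nat using (≢-nonZero⁻¹)
open import Data.Nat.Properties using (m∸n+n≡m; _!≢0)
open import Algebra.Bundles using (CommutativeSemiring; CommutativeRing)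
open import Data.List using (List; []; _∷_; _++_; map; concatMap; filter; length)
open import Data.List.Relation.Unary.All as All using (All; []; _∷_)
open import Relation.Binary.PropositionalEquality as ≡ using (_≡_; _≢_)

module ListSum {c ℓ : Level} (S : CommutativeSemiring c ℓ) where

  open CommutativeSemiring S
  open import Relation.Binary.Reasoning.Setoid setoid

  private variable A B : Set

  ∑ : (A → Carrier) → List A → Carrier
  ∑ g []       = 0#
  ∑ g (x ∷ xs) = g x + ∑ g xs

  ∑-cong : {g h : A → Carrier} (xs : List A) → All (λ x → g x ≈ h x) xs → ∑ g xs ≈ ∑ h xs
  ∑-cong []       []                = refl
  ∑-cong (x ∷ xs) (gx≈hx ∷ gxs≈hxs) = +-cong gx≈hx (∑-cong xs gxs≈hxs)

  ∑-++ : (g : A → Carrier) (xs ys : List A) → ∑ g (xs ++ ys) ≈ ∑ g xs + ∑ g ys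
  ∑-++ g []       ys = sym (+-identityˡ _)
  ∑-++ g (x ∷ xs) ys = trans (+-congˡ (∑-++ g xs ys)) (sym (+-assoc _ _ _))

  ∑-map : (g : B → Carrier) (h : A → B) (xs : List A) → ∑ g (map h xs) ≈ ∑ (λ x → g (h x)) xs
  ∑-map g h []       = refl
  ∑-map g h (x ∷ xs) = +-congˡ (∑-map g h xs)

  ∑-concatMap : (g : B → Carrier) (h : A → List B) (xs : List A) →
                ∑ g (concatMap h xs) ≈ ∑ (λ x → ∑ g (h x)) xs
  ∑-concatMap g h []       = refl
  ∑-concatMap g h (x ∷ xs) = trans (∑-++ g (h x) (concatMap h xs)) (+-congˡ (∑-concatMap g h xs))

  ∑-zero : (xs : List A) → ∑ (λ _ → 0#) xs ≈ 0#
  ∑-zero []       = refl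
  ∑-zero (x ∷ xs) = trans (+-identityˡ _) (∑-zero xs)

  ∑-+ : (g h : A → Carrier) (xs : List A) → ∑ (λ x → g x + h x) xs ≈ ∑ g xs + ∑ h xs
  ∑-+ g h []       = sym (+-identityˡ 0#)
  ∑-+ g h (x ∷ xs) = begin
    g x + h x + ∑ (λ x → g x + h x) xs ≈⟨ +-congˡ (∑-+ g h xs) ⟩
    g x + h x + (∑ g xs + ∑ h xs)      ≈⟨ +-assoc _ _ _ ⟩
    g x + (h x + (∑ g xs + ∑ h xs))    ≈⟨ +-congˡ (x∙yz≈y∙xz (h x) (∑ g xs) (∑ h xs)) ⟩
    g x + (∑ g xs + (h x + ∑ h xs))    ≈⟨ sym (+-assoc _ _ _) ⟩
    g x + ∑ g xs + (h x + ∑ h xs)      ∎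
    where open import Algebra.Properties.CommutativeSemigroup +-commutativeSemigroup using (x∙yz≈y∙xz)

  ∑-*ˡ : (k : Carrier) (g : A → Carrier) (xs : List A) → ∑ (λ x → k * g x) xs ≈ k * ∑ g xs
  ∑-*ˡ k g []       = sym (zeroʳ k)
  ∑-*ˡ k g (x ∷ xs) = trans (+-congˡ (∑-*ˡ k g xs)) (sym (distribˡ k (g x) (∑ g xs)))

  ∑-*ʳ : (k : Carrier) (g : A → Carrier) (xs : List A) → ∑ (λ x → g x * k) xs ≈ ∑ g xs * k
  ∑-*ʳ k g []       = sym (zeroˡ k)
  ∑-*ʳ k g (x ∷ xs) = trans (+-congˡ (∑-*ʳ k g xs)) (sym (distribʳ k (g x) (∑ g xs)))

module Combinatorics where

  open import Data.Nat using (zero; _+_; _*_; _≟_; _≡ᵇ_; _<?_; z≤n; s≤s)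
  open import Data.Nat.Properties
  open import Data.Nat.Combinatorics using (_C_; nCn≡1; nC1≡n; nCk≡nC[n∸k]; k>n⇒nCk≡0)
    renaming (nCk+nC[k+1]≡[n+1]C[k+1] to pascal)
  open import Data.Nat.Tactic.RingSolver using (solve-∀)
  open import Data.Bool using (true; false; if_then_else_)
  open import Data.Empty using (⊥-elim)
  open import Data.Product using (_×_; _,_)
  import Data.List.Relation.Unary.All.Properties as AllP
  open import Relation.Nullary using (yes; no)
  open import Relation.Nullary.Decidable using (⌊_⌋)
  open ≡ using (refl; sym; trans; cong; cong₂)
  open ≡.≡-Reasoning
  open ListSum +-*-commutativeSemiring

  private variable A : Set

  δ : ℕ → ℕ → ℕ
  δ a b = if a ≡ᵇ b then 1 else 0

  δ-self : ∀ a → δ a a ≡ 1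
  δ-self a with a ≡ᵇ a | ≡⇒≡ᵇ a a refl
  ... | true  | _  = refl
  ... | false | ()

  δ-≢ : ∀ {a b} → a ≢ b → δ a b ≡ 0
  δ-≢ {a} {b} a≢b with a ≡ᵇ b | ≡ᵇ⇒≡ a b
  ... | false | _    = refl
  ... | true  | a≡b = ⊥-elim (a≢b (a≡b _))

  *-δ : ∀ a b → a * δ a b ≡ b * δ a b
  *-δ a b with a ≟ b
  ... | yes refl = refl
  ... | no a≢b rewrite δ-≢ a≢b = trans (*-zeroʳ a) (sym (*-zeroʳ b))

  length-filter≡∑δ : (f : A → ℕ) (j : ℕ) (xs : List A) →
                     length (filter (λ x → f x ≟ j) xs) ≡ ∑ (λ x → δ (f x) j) xs
  length-filter≡∑δ f j []       = refl
  length-filter≡∑δ f j (x ∷ xs) with f x ≡ᵇ j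
  ... | true  = cong suc (length-filter≡∑δ f j xs)
  ... | false = length-filter≡∑δ f j xs

  -- Set partitions

  stirling2≡∑δ : ∀ m j → stirling2 m j ≡ ∑ (λ P → δ (length P) j) (setPartitions m)
  stirling2≡∑δ m j = length-filter≡∑δ length j (setPartitions m)

  ∑-addToBlocks : ∀ a P (g : ℕ → ℕ) → ∑ (λ Q → g (length Q)) (addToBlocks a P) ≡ length P * g (length P)
  ∑-addToBlocks a []       g = refl
  ∑-addToBlocks a (B ∷ Bs) g = cong (g (suc (length Bs)) +_) (begin
    ∑ (λ Q → g (length Q)) (map (B ∷_) (addToBlocks a Bs)) ≡⟨ ∑-map _ (B ∷_) (addToBlocks a Bs) ⟩
    ∑ (λ Q → g (suc (length Q))) (addToBlocks a Bs)      ≡⟨ ∑-addToBlocks a Bs (λ k → g (suc k)) ⟩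
    length Bs * g (suc (length Bs))                        ∎)

  stirling2-suc : ∀ m j → stirling2 (suc m) j ≡
                  ∑ (λ P → δ (suc (length P)) j + length P * δ (length P) j) (setPartitions m)
  stirling2-suc m j = begin
    stirling2 (suc m) j
      ≡⟨ stirling2≡∑δ (suc m) j ⟩
    ∑ (λ P → δ (length P) j) (concatMap newBlockOrNot (setPartitions m))
      ≡⟨ ∑-concatMap (λ P → δ (length P) j) newBlockOrNot (setPartitions m) ⟩
    ∑ (λ P → ∑ (λ Q → δ (length Q) j) (newBlockOrNot P)) (setPartitions m)
      ≡⟨ ∑-cong (setPartitions m) (All.universal (λ P → cong (δ (suc (length P)) j +_)
                                                           (∑-addToBlocks (suc m) P (λ k → δ k j))) _) ⟩
    ∑ (λ P → δ (suc (length P)) j + length P * δ (length P) j) (setPartitions m) ∎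
    where
    newBlockOrNot : List (List ℕ) → List (List (List ℕ))
    newBlockOrNot P = ((suc m ∷ []) ∷ P) ∷ addToBlocks (suc m) P

  stirling2-suc-zero : ∀ m → stirling2 (suc m) 0 ≡ 0
  stirling2-suc-zero m = trans (stirling2-suc m 0)
    (trans (∑-cong (setPartitions m) (All.universal (λ P → *-δ (length P) 0) _)) (∑-zero (setPartitions m)))

  stirling2-suc-suc : ∀ m j → stirling2 (suc m) (suc j) ≡ stirling2 m j + suc j * stirling2 m (suc j)
  stirling2-suc-suc m j = begin
    stirling2 (suc m) (suc j)
      ≡⟨ stirling2-suc m (suc j) ⟩
    ∑ (λ P → δ (length P) j + length P * δ (length P) (suc j)) Πₘ
      ≡⟨ ∑-cong Πₘ (All.universal (λ P → cong (δ (length P) j +_) (*-δ (length P) (suc j))) Πₘ) ⟩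
    ∑ (λ P → δ (length P) j + suc j * δ (length P) (suc j)) Πₘ
      ≡⟨ ∑-+ _ _ Πₘ ⟩
    ∑ (λ P → δ (length P) j) Πₘ + ∑ (λ P → suc j * δ (length P) (suc j)) Πₘ
      ≡⟨ cong (∑ (λ P → δ (length P) j) Πₘ +_) (∑-*ˡ (suc j) _ Πₘ) ⟩
    ∑ (λ P → δ (length P) j) Πₘ + suc j * ∑ (λ P → δ (length P) (suc j)) Πₘ
      ≡⟨ cong₂ (λ a b → a + suc j * b) (sym (stirling2≡∑δ m j)) (sym (stirling2≡∑δ m (suc j))) ⟩
    stirling2 m j + suc j * stirling2 m (suc j) ∎
    where Πₘ = setPartitions m

  stirling2-< : ∀ {m j} → m <ℕ j → stirling2 m j ≡ 0
  stirling2-< {zero}  {suc j} _ = refl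
  stirling2-< {suc m} {suc j} (s≤s m<j)
    rewrite stirling2-suc-suc m j | stirling2-< m<j | stirling2-< (m<n⇒m<1+n m<j) = *-zeroʳ (suc j)

  stirling2-diag : ∀ m → stirling2 m m ≡ 1
  stirling2-diag zero = refl
  stirling2-diag (suc m)
    rewrite stirling2-suc-suc m m | stirling2-diag m | stirling2-< (n<1+n m) | *-zeroʳ (suc m) = refl

  stirling2-one : ∀ m → stirling2 (suc m) 1 ≡ 1
  stirling2-one zero = refl
  stirling2-one (suc m) rewrite stirling2-suc-suc (suc m) 0 | stirling2-suc-zero m | stirling2-one m = refl

  nC0≡1 : ∀ n → n C 0 ≡ 1
  nC0≡1 n = trans (nCk≡nC[n∸k] {0} {n} z≤n) (nCn≡1 n)

  C-absorption : ∀ m q → suc q * (m C suc q) + q * (m C q) ≡ m * (m C q)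
  C-absorption zero    zero     = refl
  C-absorption zero    (suc q)  rewrite k>n⇒nCk≡0 {0} {suc q} (s≤s z≤n) | *-zeroʳ (suc (suc q)) = refl
  C-absorption (suc m) zero
    rewrite nC1≡n (suc m) | nC0≡1 (suc m) | +-identityʳ (1 * suc m) = sym (*-comm (suc m) 1)
  C-absorption (suc m) (suc q′) = begin
    suc q * (suc m C suc q) + q * (suc m C q)
      ≡⟨ cong₂ (λ a b → suc q * a + q * b) (sym (pascal m q)) (sym (pascal m q′)) ⟩
    suc q * (m C q + m C suc q) + q * (m C q′ + m C q)
      ≡⟨ regroup q′ (m C q′) (m C q) (m C suc q) ⟩
    (suc q * (m C suc q) + q * (m C q)) + ((q * (m C q) + q′ * (m C q′)) + m C q′ + m C q)
      ≡⟨ cong₂ (λ a b → a + (b + m C q′ + m C q)) (C-absorption m q) (C-absorption m q′) ⟩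
    m * (m C q) + (m * (m C q′) + m C q′ + m C q)
      ≡⟨ collect m (m C q′) (m C q) ⟩
    suc m * (m C q′ + m C q) ≡⟨ cong (suc m *_) (pascal m q′) ⟩
    suc m * (suc m C q) ∎
    where
    q = suc q′
    regroup : ∀ q′ x y z → suc (suc q′) * (y + z) + suc q′ * (x + y)
                          ≡ (suc (suc q′) * z + suc q′ * y) + ((suc q′ * y + q′ * x) + x + y)
    regroup = solve-∀
    collect : ∀ m x y → m * y + (m * x + x + y) ≡ suc m * (x + y)
    collect = solve-∀

  -- Descents of permutations

  isDescent : ℕ → ℕ → ℕ
  isDescent b c = if ⌊ c <? b ⌋ then 1 else 0

  isDescent≤1 : ∀ b c → isDescent b c ≤ 1
  isDescent≤1 b c with c <? b
  ... | yes _ = s≤s z≤n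
  ... | no _  = z≤n

  isDescent-< : ∀ {b c} → b <ℕ c → isDescent b c ≡ 0
  isDescent-< {b} {c} b<c with c <? b
  ... | yes c<b = ⊥-elim (<-asym b<c c<b)
  ... | no _    = refl

  isDescent-> : ∀ {b c} → c <ℕ b → isDescent b c ≡ 1
  isDescent-> {b} {c} c<b with c <? b
  ... | yes _   = refl
  ... | no c≮b = ⊥-elim (c≮b c<b)

  private
    x+[y+z]≡y+[x+z] : ∀ x y z → x + (y + z) ≡ y + (x + z)
    x+[y+z]≡y+[x+z] = solve-∀

    insertion-step : ∀ e → e ≤ 1 → ∀ (g : ℕ → ℕ) D L X →
      X + D * g (e + suc D) ≡ suc D * g (e + D) + L * g (e + suc D) →
      g (suc D) + X + (e + D) * g (suc (e + D)) ≡ suc (e + D) * g (e + D) + suc L * g (suc (e + D))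
    insertion-step zero z≤n g D L X hyp = begin
      g (suc D) + X + D * g (suc D)           ≡⟨ +-assoc (g (suc D)) X _ ⟩
      g (suc D) + (X + D * g (suc D))         ≡⟨ cong (g (suc D) +_) hyp ⟩
      g (suc D) + (suc D * g D + L * g (suc D)) ≡⟨ x+[y+z]≡y+[x+z] (g (suc D)) (suc D * g D) (L * g (suc D)) ⟩
      suc D * g D + suc L * g (suc D)          ∎
    insertion-step (suc zero) (s≤s z≤n) g D L X hyp = begin
      u + X + suc D * v            ≡⟨ regroup u v X D ⟩
      u + v + (X + D * v)          ≡⟨ cong (u + v +_) hyp ⟩
      u + v + (suc D * u + L * v)  ≡⟨ collect u v D L ⟩
      suc (suc D) * u + suc L * v  ∎
      where
      u = g (suc D)
      v = g (suc (suc D))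
      regroup : ∀ A B X D → A + X + suc D * B ≡ A + B + (X + D * B)
      regroup = solve-∀
      collect : ∀ A B D L → A + B + (suc D * A + L * B) ≡ suc (suc D) * A + suc L * B
      collect = solve-∀

  descents-insertions-after : ∀ a b (w : List ℕ) (g : ℕ → ℕ) → b <ℕ a → All (_<ℕ a) w →
    ∑ (λ v → g (descents (b ∷ v))) (insertions a w) + descents (b ∷ w) * g (suc (descents (b ∷ w)))
      ≡ suc (descents (b ∷ w)) * g (descents (b ∷ w)) + length w * g (suc (descents (b ∷ w)))
  descents-insertions-after a b [] g b<a [] rewrite isDescent-< b<a = refl
  descents-insertions-after a b (c ∷ cs) g b<a (c<a ∷ cs<a)
    rewrite isDescent-< b<a | isDescent-> c<a
          | ∑-map (λ v → g (descents (b ∷ v))) (c ∷_) (insertions a cs) =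
    insertion-step (isDescent b c) (isDescent≤1 b c) g (descents (c ∷ cs)) (length cs) _
      (descents-insertions-after a c cs (λ k → g (isDescent b c + k)) c<a cs<a)

  -- Of the |w| + 1 insertions of a letter larger than all of w, d + 1 keep the d descents of w and the
  -- others add one; both sides are moved so that no subtraction occurs.
  descents-insertions : ∀ a (w : List ℕ) (g : ℕ → ℕ) → All (_<ℕ a) w →
    ∑ (λ v → g (descents v)) (insertions a w) + descents w * g (suc (descents w))
      ≡ suc (descents w) * g (descents w) + length w * g (suc (descents w))
  descents-insertions a []       g []           = refl
  descents-insertions a (b ∷ bs) g (b<a ∷ bs<a) rewrite isDescent-> b<a = begin
    g (suc d) + ∑ (λ v → g (descents v)) (map (b ∷_) (insertions a bs)) + d * g (suc d)
      ≡⟨ +-assoc (g (suc d)) _ _ ⟩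
    g (suc d) + (∑ (λ v → g (descents v)) (map (b ∷_) (insertions a bs)) + d * g (suc d))
      ≡⟨ cong (λ s → g (suc d) + (s + d * g (suc d))) (∑-map _ (b ∷_) (insertions a bs)) ⟩
    g (suc d) + (∑ (λ v → g (descents (b ∷ v))) (insertions a bs) + d * g (suc d))
      ≡⟨ cong (g (suc d) +_) (descents-insertions-after a b bs g b<a bs<a) ⟩
    g (suc d) + (suc d * g d + length bs * g (suc d))
      ≡⟨ x+[y+z]≡y+[x+z] (g (suc d)) (suc d * g d) (length bs * g (suc d)) ⟩
    suc d * g d + suc (length bs) * g (suc d) ∎
    where d = descents (b ∷ bs)

  insertions-All : ∀ {P : ℕ → Set} {a} (w : List ℕ) → P a → All P w → All (All P) (insertions a w)
  insertions-All []       pa []         = (pa ∷ []) ∷ []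
  insertions-All (b ∷ bs) pa (pb ∷ pbs) =
    (pa ∷ pb ∷ pbs) ∷ AllP.map⁺ (All.map (pb ∷_) (insertions-All bs pa pbs))

  insertions-length : ∀ a (w : List ℕ) → All (λ v → length v ≡ suc (length w)) (insertions a w)
  insertions-length a []       = refl ∷ []
  insertions-length a (b ∷ bs) = refl ∷ AllP.map⁺ (All.map (cong suc) (insertions-length a bs))

  Word : ℕ → List ℕ → Set
  Word n σ = All (_<ℕ suc n) σ × length σ ≡ n

  perms-Word : ∀ n → All (Word n) (perms n)
  perms-Word zero    = ([] , refl) ∷ []
  perms-Word (suc n) = AllP.concat⁺ (AllP.map⁺ (All.map insertions-Word (perms-Word n)))
    where
    insertions-Word : ∀ {σ} → Word n σ → All (Word (suc n)) (insertions (suc n) σ)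
    insertions-Word {σ} (σ<1+n , ∣σ∣≡n) =
      All.zipWith (λ (v<2+n , ∣v∣≡1+∣σ∣) → v<2+n , trans ∣v∣≡1+∣σ∣ (cong suc ∣σ∣≡n))
                  (insertions-All σ ≤-refl (All.map m<n⇒m<1+n σ<1+n) , insertions-length (suc n) σ)

  descents≤length : ∀ b (bs : List ℕ) → descents (b ∷ bs) ≤ length bs
  descents≤length b []       = z≤n
  descents≤length b (c ∷ cs) = +-mono-≤ (isDescent≤1 b c) (descents≤length c cs)

  descents<length : ∀ {n σ} → Word (suc n) σ → descents σ <ℕ suc n
  descents<length {σ = b ∷ bs} (_ , ∣σ∣≡1+n) =
    s≤s (≡.subst (descents (b ∷ bs) ≤_) (suc-injective ∣σ∣≡1+n) (descents≤length b bs))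

  -- The coefficient of z^q in A_n(1 + z) = ∑_σ (1 + z)^(des σ + 1).
  taylorCoeff : ℕ → ℕ → ℕ
  taylorCoeff n q = ∑ (λ σ → suc (descents σ) C q) (perms n)

  taylorCoeff-suc : ∀ n q → taylorCoeff (suc n) q ≡
                    ∑ (λ σ → ∑ (λ v → suc (descents v) C q) (insertions (suc n) σ)) (perms n)
  taylorCoeff-suc n q = ∑-concatMap (λ v → suc (descents v) C q) (insertions (suc n)) (perms n)

  taylorCoeff-suc-zero : ∀ n → taylorCoeff (suc n) 0 ≡ suc n * taylorCoeff n 0
  taylorCoeff-suc-zero n = begin
    taylorCoeff (suc n) 0
      ≡⟨ taylorCoeff-suc n 0 ⟩
    ∑ (λ σ → ∑ (λ v → suc (descents v) C 0) (insertions (suc n) σ)) (perms n)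
      ≡⟨ ∑-cong (perms n) (All.map insertion-count (perms-Word n)) ⟩
    ∑ (λ σ → suc n * (suc (descents σ) C 0)) (perms n)
      ≡⟨ ∑-*ˡ (suc n) _ (perms n) ⟩
    suc n * taylorCoeff n 0 ∎
    where
    insertion-count : ∀ {σ} → Word n σ →
                      ∑ (λ v → suc (descents v) C 0) (insertions (suc n) σ) ≡ suc n * (suc (descents σ) C 0)
    insertion-count {σ} (σ<1+n , ∣σ∣≡n) = begin
      ∑ (λ v → suc (descents v) C 0) (insertions (suc n) σ)
        ≡⟨ ∑-cong (insertions (suc n) σ) (All.universal (λ v → nC0≡1 (suc (descents v))) _) ⟩
      ∑ (λ _ → 1) (insertions (suc n) σ)
        ≡⟨ +-cancelʳ-≡ (d * 1) _ _ (trans (descents-insertions (suc n) σ (λ _ → 1) σ<1+n) (swap d (length σ))) ⟩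
      suc (length σ) * 1
        ≡⟨ cong₂ (λ l c → suc l * c) ∣σ∣≡n (sym (nC0≡1 (suc d))) ⟩
      suc n * (suc d C 0) ∎
      where
      d = descents σ
      swap : ∀ d l → suc d * 1 + l * 1 ≡ suc l * 1 + d * 1
      swap = solve-∀

  private
    pascal-step : ∀ d j q X Y → suc q * X + q * Y ≡ suc d * Y →
                  suc d * X + (j + q) * (Y + X) ≡ d * (Y + X) + (j * X + suc j * Y)
    pascal-step d j q X Y absorb = begin
      suc d * X + (j + q) * (Y + X)                ≡⟨ expand d j q X Y ⟩
      d * X + j * Y + j * X + (suc q * X + q * Y)  ≡⟨ cong (d * X + j * Y + j * X +_) absorb ⟩
      d * X + j * Y + j * X + suc d * Y            ≡⟨ collect d j X Y ⟩
      d * (Y + X) + (j * X + suc j * Y)            ∎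
      where
      expand : ∀ d j q X Y → suc d * X + (j + q) * (Y + X) ≡ d * X + j * Y + j * X + (suc q * X + q * Y)
      expand = solve-∀
      collect : ∀ d j X Y → d * X + j * Y + j * X + suc d * Y ≡ d * (Y + X) + (j * X + suc j * Y)
      collect = solve-∀

  taylorCoeff-suc-suc : ∀ n j q → j + q ≡ n →
                        taylorCoeff (suc n) (suc q) ≡ j * taylorCoeff n (suc q) + suc j * taylorCoeff n q
  taylorCoeff-suc-suc n j q j+q≡n = begin
    taylorCoeff (suc n) (suc q)
      ≡⟨ taylorCoeff-suc n (suc q) ⟩
    ∑ (λ σ → ∑ (λ v → suc (descents v) C suc q) (insertions (suc n) σ)) (perms n)
      ≡⟨ ∑-cong (perms n) (All.map insertion-count (perms-Word n)) ⟩
    ∑ (λ σ → j * (suc (descents σ) C suc q) + suc j * (suc (descents σ) C q)) (perms n)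
      ≡⟨ ∑-+ _ _ (perms n) ⟩
    ∑ (λ σ → j * (suc (descents σ) C suc q)) (perms n) + ∑ (λ σ → suc j * (suc (descents σ) C q)) (perms n)
      ≡⟨ cong₂ _+_ (∑-*ˡ j _ (perms n)) (∑-*ˡ (suc j) _ (perms n)) ⟩
    j * taylorCoeff n (suc q) + suc j * taylorCoeff n q ∎
    where
    insertion-count : ∀ {σ} → Word n σ →
                      ∑ (λ v → suc (descents v) C suc q) (insertions (suc n) σ)
                        ≡ j * (suc (descents σ) C suc q) + suc j * (suc (descents σ) C q)
    insertion-count {σ} (σ<1+n , ∣σ∣≡n) = +-cancelˡ-≡ (d * (Y + X)) _ _ (begin
      d * (Y + X) + Σ
        ≡⟨ +-comm (d * (Y + X)) Σ ⟩
      Σ + d * (Y + X)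
        ≡⟨ cong (λ c → Σ + d * c) (pascal (suc d) q) ⟩
      Σ + d * (suc (suc d) C suc q)
        ≡⟨ descents-insertions (suc n) σ (λ k → suc k C suc q) σ<1+n ⟩
      suc d * X + length σ * (suc (suc d) C suc q)
        ≡⟨ cong₂ (λ l c → suc d * X + l * c) (trans ∣σ∣≡n (sym j+q≡n)) (sym (pascal (suc d) q)) ⟩
      suc d * X + (j + q) * (Y + X)
        ≡⟨ pascal-step d j q X Y (C-absorption (suc d) q) ⟩
      d * (Y + X) + (j * X + suc j * Y) ∎)
      where
      d = descents σ
      X = suc d C suc q
      Y = suc d C q
      Σ = ∑ (λ v → suc (descents v) C suc q) (insertions (suc n) σ)

  taylorCoeff-stirling2 : ∀ n j q → j + q ≡ n → taylorCoeff n q ≡ j ! * stirling2 (suc n) (suc j)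
  taylorCoeff-stirling2 zero    zero q       refl = refl
  taylorCoeff-stirling2 (suc n) j    zero    j+0≡1+n rewrite +-identityʳ j | j+0≡1+n
    | taylorCoeff-suc-zero n | taylorCoeff-stirling2 n n 0 (+-identityʳ n)
    | stirling2-diag (suc n) | stirling2-diag (suc (suc n)) = sym (*-assoc (suc n) (n !) 1)
  taylorCoeff-stirling2 (suc n) j    (suc q) j+1+q≡1+n = begin
    taylorCoeff (suc n) (suc q)
      ≡⟨ taylorCoeff-suc-suc n j q j+q≡n ⟩
    j * taylorCoeff n (suc q) + suc j * taylorCoeff n q
      ≡⟨ cong (λ t → j * taylorCoeff n (suc q) + suc j * t) (taylorCoeff-stirling2 n j q j+q≡n) ⟩
    j * taylorCoeff n (suc q) + suc j * (j ! * stirling2 (suc n) (suc j))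
      ≡⟨ closed-form-recurrence j j+q≡n ⟩
    j ! * stirling2 (suc (suc n)) (suc j) ∎
    where
    j+q≡n : j + q ≡ n
    j+q≡n = suc-injective (trans (sym (+-suc j q)) j+1+q≡1+n)
    closed-form-recurrence : ∀ j → j + q ≡ n →
      j * taylorCoeff n (suc q) + suc j * (j ! * stirling2 (suc n) (suc j)) ≡ j ! * stirling2 (suc (suc n)) (suc j)
    closed-form-recurrence zero _ rewrite stirling2-suc-suc (suc n) 0 | stirling2-suc-zero n = refl
    closed-form-recurrence (suc j) j+1+q≡n
      rewrite stirling2-suc-suc (suc n) (suc j) | taylorCoeff-stirling2 n j (suc q) (trans (+-suc j q) j+1+q≡n) =
      collect j (j !) (stirling2 (suc n) (suc j)) (stirling2 (suc n) (suc (suc j)))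
      where
      collect : ∀ j F a b → suc j * (F * a) + suc (suc j) * ((suc j * F) * b) ≡ (suc j * F) * (a + suc (suc j) * b)
      collect = solve-∀

  taylorCoeff-top : ∀ n → taylorCoeff n n ≡ 1
  taylorCoeff-top n = trans (taylorCoeff-stirling2 n 0 n refl) (cong (_+ 0) (stirling2-one n))

  taylorCoeff-zero : ∀ n → taylorCoeff n 0 ≡ n !
  taylorCoeff-zero n = trans (taylorCoeff-stirling2 n n 0 (+-identityʳ n))
                             (trans (cong (n ! *_) (stirling2-diag (suc n))) (*-identityʳ (n !)))

module Reals (R : RealField) where

  open RealOps R
  open import Data.Nat as ℕ using (zero; z≤n; s≤s)
  import Data.Nat.Properties as ℕₚ
  open import Data.Product using (Σ; _×_; _,_)
  open import Data.Sum using (inj₁; inj₂)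
  open import Data.Empty using (⊥-elim)
  open import Relation.Nullary using (yes; no)
  open import Data.Fin.Properties using (toℕ<n)
  open import Relation.Binary.Definitions using (tri<; tri≈; tri>)
  open import Relation.Binary.Reasoning.Setoid setoid
  open import Algebra.Solver.Ring.NaturalCoefficients.Default commutativeSemiring
    using (solve; _:=_; _:+_; _:*_; con)
  open import Algebra.Properties.AbelianGroup +-abelianGroup
    using (⁻¹-involutive; ⁻¹-anti-homo‿-; ⁻¹-∙-comm; x∙y⁻¹≈ε⇒x≈y)
  open import Algebra.Properties.Ring (CommutativeRing.ring commRing) using (-1*x≈-x; x[y-z]≈xy-xz)
  open import Algebra.Properties.Semiring.Mult semiring using (×-homo-+; ×1-homo-*) renaming (_×_ to _times_)
  open import Data.Nat.Combinatorics using (_C_; k>n⇒nCk≡0) renaming (nCk+nC[k+1]≡[n+1]C[k+1] to pascal)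
  open Combinatorics
    using (δ; δ-self; δ-≢; length-filter≡∑δ; perms-Word; descents<length; nC0≡1; taylorCoeff; taylorCoeff-top)
  open import Algebra.Properties.CommutativeMonoid.Sum *-commutativeMonoid
    using () renaming (sum to ∏; sum-cong-≋ to ∏-cong; ∑-distrib-+ to ∏-distrib-*)
  module ℕΣ = ListSum ℕₚ.+-*-commutativeSemiring
  open ListSum commutativeSemiring

  x-y+y≈x : ∀ x y → (x - y) + y ≈ x
  x-y+y≈x x y = begin
    (x - y) + y   ≈⟨ +-assoc x (- y) y ⟩
    x + (- y + y) ≈⟨ +-congˡ (-‿inverseˡ y) ⟩
    x + 0#        ≈⟨ +-identityʳ x ⟩
    x             ∎

  [x-y]z+yz≈xz : ∀ x y z → (x - y) * z + y * z ≈ x * z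
  [x-y]z+yz≈xz x y z = trans (sym (distribʳ z (x - y) y)) (*-congʳ (x-y+y≈x x y))

  x≉0∧xy≈z⇒y≈zx⁻¹ : ∀ {x y z} → x ≉ 0# → x * y ≈ z → y ≈ z * x ⁻¹
  x≉0∧xy≈z⇒y≈zx⁻¹ {x} {y} {z} x≉0 xy≈z = begin
    y                ≈⟨ sym (*-identityˡ y) ⟩
    1# * y           ≈⟨ *-congʳ (sym (⁻¹-inverse x x≉0)) ⟩
    (x * x ⁻¹) * y   ≈⟨ solve 3 (λ x x⁻¹ y → (x :* x⁻¹) :* y := (x :* y) :* x⁻¹) refl x (x ⁻¹) y ⟩
    (x * y) * x ⁻¹   ≈⟨ *-congʳ xy≈z ⟩
    z * x ⁻¹         ∎

  x*y≈0⇒y≈0 : ∀ {x y} → x ≉ 0# → x * y ≈ 0# → y ≈ 0#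
  x*y≈0⇒y≈0 x≉0 xy≈0 = trans (x≉0∧xy≈z⇒y≈zx⁻¹ x≉0 xy≈0) (zeroˡ _)

  x≉0∧y≉0⇒xy≉0 : ∀ {x y} → x ≉ 0# → y ≉ 0# → x * y ≉ 0#
  x≉0∧y≉0⇒xy≉0 x≉0 y≉0 xy≈0 = y≉0 (x*y≈0⇒y≈0 x≉0 xy≈0)

  <⇒≉ : ∀ {x y} → x < y → x ≉ y
  <⇒≉ x<y x≈y = <-irrefl (<-respˡ-≈ x≈y x<y)

  -- If 1 < 0 then 0 < -1, hence 0 < (-1) * (-1) = 1.
  0<1 : 0# < 1#
  0<1 with <-trichotomy 0# 1#
  ... | inj₁ 0<1       = 0<1
  ... | inj₂ (inj₁ 0≈1) = ⊥-elim (0≉1 0≈1)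
  ... | inj₂ (inj₂ 1<0) = ⊥-elim (<-irrefl (<-trans 0<1′ 1<0))
    where
    0<-1 : 0# < (- 1#)
    0<-1 = <-respˡ-≈ (-‿inverseʳ 1#) (<-respʳ-≈ (+-identityˡ (- 1#)) (+-mono-< (- 1#) 1<0))
    0<1′ : 0# < 1#
    0<1′ = <-respʳ-≈ (trans (-1*x≈-x (- 1#)) (⁻¹-involutive 1#)) (*-pos 0<-1 0<-1)

  fromℕ1≈1 : fromℕ 1 ≈ 1#
  fromℕ1≈1 = +-identityʳ 1#

  fromℕ≡×1 : ∀ n → fromℕ n ≡ n times 1#
  fromℕ≡×1 zero    = ≡.refl
  fromℕ≡×1 (suc n) = ≡.cong (1# +_) (fromℕ≡×1 n)

  fromℕ-+ : ∀ m n → fromℕ (m ℕ.+ n) ≈ fromℕ m + fromℕ n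
  fromℕ-+ m n rewrite fromℕ≡×1 m | fromℕ≡×1 n | fromℕ≡×1 (m ℕ.+ n) = ×-homo-+ 1# m n

  fromℕ-* : ∀ m n → fromℕ (m ℕ.* n) ≈ fromℕ m * fromℕ n
  fromℕ-* m n rewrite fromℕ≡×1 m | fromℕ≡×1 n | fromℕ≡×1 (m ℕ.* n) = ×1-homo-* m n

  fromℕ-< : ∀ {m n} → m <ℕ n → fromℕ m < fromℕ n
  fromℕ-< {m} {n} m<n = go (ℕₚ.≤⇒≤′ m<n)
    where
    n<1+n : ∀ n → fromℕ n < fromℕ (suc n)
    n<1+n n = <-respˡ-≈ (+-identityˡ (fromℕ n)) (+-mono-< (fromℕ n) 0<1)
    go : ∀ {n} → suc m ℕ.≤′ n → fromℕ m < fromℕ n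
    go ℕ.≤′-refl       = n<1+n m
    go {suc n} (ℕ.≤′-step m<n) = <-trans (go m<n) (n<1+n n)

  fromℕ-≢ : ∀ {m n} → m ≢ n → fromℕ m ≉ fromℕ n
  fromℕ-≢ {m} {n} m≢n with ℕₚ.<-cmp m n
  ... | tri< m<n _ _ = <⇒≉ (fromℕ-< m<n)
  ... | tri≈ _ m≡n _ = ⊥-elim (m≢n m≡n)
  ... | tri> _ _ n<m = λ m≈n → <⇒≉ (fromℕ-< n<m) (sym m≈n)

  fromℕ-suc≉0 : ∀ n → fromℕ (suc n) ≉ 0#
  fromℕ-suc≉0 n = fromℕ-≢ {suc n} {0} (λ ())

  fromℕ-∑ : {A : Set} (h : A → ℕ) (xs : List A) → fromℕ (ℕΣ.∑ h xs) ≈ ∑ (λ x → fromℕ (h x)) xs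
  fromℕ-∑ h []       = refl
  fromℕ-∑ h (x ∷ xs) = trans (fromℕ-+ (h x) (ℕΣ.∑ h xs)) (+-congˡ (fromℕ-∑ h xs))

  ∏≉0 : ∀ {n} (u : Fin n → Carrier) → (∀ i → u i ≉ 0#) → ∏ u ≉ 0#
  ∏≉0 {zero}  u u≉0 1≈0 = 0≉1 (sym 1≈0)
  ∏≉0 {suc n} u u≉0     =
    x≉0∧y≉0⇒xy≉0 (u≉0 Fin.zero) (∏≉0 (λ i → u (Fin.suc i)) (λ i → u≉0 (Fin.suc i)))

  ∏≉0⇒≉0 : ∀ {n} (u : Fin n → Carrier) → ∏ u ≉ 0# → ∀ i → u i ≉ 0#
  ∏≉0⇒≉0 u ∏u≉0 Fin.zero    ui≈0 = ∏u≉0 (trans (*-congʳ ui≈0) (zeroˡ _))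
  ∏≉0⇒≉0 u ∏u≉0 (Fin.suc i) =
    ∏≉0⇒≉0 (λ i → u (Fin.suc i)) (λ ∏≈0 → ∏u≉0 (trans (*-congˡ ∏≈0) (zeroʳ _))) i

  -- Polynomial functions

  poly : ℕ → (ℕ → Carrier) → Carrier → Carrier
  poly zero    a z = a 0
  poly (suc n) a z = a 0 + z * poly n (λ p → a (suc p)) z

  poly-cong : ∀ n {a b} z → (∀ p → a p ≈ b p) → poly n a z ≈ poly n b z
  poly-cong zero    z a≈b = a≈b 0
  poly-cong (suc n) z a≈b = +-cong (a≈b 0) (*-congˡ (poly-cong n z (λ p → a≈b (suc p))))

  poly-0# : ∀ n z → poly n (λ _ → 0#) z ≈ 0#
  poly-0# zero    z = refl
  poly-0# (suc n) z = trans (+-identityˡ _) (trans (*-congˡ (poly-0# n z)) (zeroʳ z))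

  poly-at-0# : ∀ n a → poly n a 0# ≈ a 0
  poly-at-0# zero    a = refl
  poly-at-0# (suc n) a = trans (+-congˡ (zeroˡ _)) (+-identityʳ _)

  poly-+ : ∀ n a b z → poly n (λ p → a p + b p) z ≈ poly n a z + poly n b z
  poly-+ zero    a b z = refl
  poly-+ (suc n) a b z = begin
    a 0 + b 0 + z * poly n (λ p → a (suc p) + b (suc p)) z
      ≈⟨ +-congˡ (*-congˡ (poly-+ n _ _ z)) ⟩
    a 0 + b 0 + z * (A + B)
      ≈⟨ solve 5 (λ a b z A B → a :+ b :+ z :* (A :+ B) := a :+ z :* A :+ (b :+ z :* B)) refl (a 0) (b 0) z A B ⟩
    a 0 + z * A + (b 0 + z * B) ∎
    where
    A = poly n (λ p → a (suc p)) z
    B = poly n (λ p → b (suc p)) z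

  poly-*ˡ : ∀ n k a z → poly n (λ p → k * a p) z ≈ k * poly n a z
  poly-*ˡ zero    k a z = refl
  poly-*ˡ (suc n) k a z = begin
    k * a 0 + z * poly n (λ p → k * a (suc p)) z
      ≈⟨ +-congˡ (*-congˡ (poly-*ˡ n k _ z)) ⟩
    k * a 0 + z * (k * A)
      ≈⟨ solve 4 (λ k a z A → k :* a :+ z :* (k :* A) := k :* (a :+ z :* A)) refl k (a 0) z A ⟩
    k * (a 0 + z * A) ∎
    where A = poly n (λ p → a (suc p)) z

  poly-minus : ∀ n a b z → poly n (λ p → a p - b p) z ≈ poly n a z - poly n b z
  poly-minus zero    a b z = refl
  poly-minus (suc n) a b z = begin
    (a 0 - b 0) + z * poly n (λ p → a (suc p) - b (suc p)) z
      ≈⟨ +-congˡ (*-congˡ (poly-minus n _ _ z)) ⟩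
    (a 0 - b 0) + z * (A - B)
      ≈⟨ +-congˡ (x[y-z]≈xy-xz z A B) ⟩
    (a 0 - b 0) + (z * A - z * B)
      ≈⟨ solve 4 (λ a -b zA -zB → a :+ -b :+ (zA :+ -zB) := a :+ zA :+ (-b :+ -zB)) refl (a 0) (- b 0) (z * A) (- (z * B)) ⟩
    (a 0 + z * A) + (- b 0 - z * B)
      ≈⟨ +-congˡ (⁻¹-∙-comm (b 0) (z * B)) ⟩
    (a 0 + z * A) - (b 0 + z * B) ∎
    where
    A = poly n (λ p → a (suc p)) z
    B = poly n (λ p → b (suc p)) z

  poly-∑ : {A : Set} (n : ℕ) (a : A → ℕ → Carrier) (z : Carrier) (xs : List A) →
           ∑ (λ x → poly n (a x) z) xs ≈ poly n (λ p → ∑ (λ x → a x p) xs) z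
  poly-∑ n a z []       = sym (poly-0# n z)
  poly-∑ n a z (x ∷ xs) = trans (+-congˡ (poly-∑ n a z xs)) (sym (poly-+ n _ _ z))

  poly-truncate : ∀ n a z → a (suc n) ≈ 0# → poly (suc n) a z ≈ poly n a z
  poly-truncate zero    a z a₁≈0 = trans (+-congˡ (trans (*-congˡ a₁≈0) (zeroʳ z))) (+-identityʳ _)
  poly-truncate (suc n) a z aₙ≈0 = +-congˡ (*-congˡ (poly-truncate n (λ p → a (suc p)) z aₙ≈0))

  -- g is a polynomial function of degree at most n whose coefficient of tⁿ is c.
  IsPolynomial : ℕ → Carrier → (Carrier → Carrier) → Set
  IsPolynomial zero    c g = ∀ t → g t ≈ c
  IsPolynomial (suc n) c g =
    Σ Carrier λ d → Σ (Carrier → Carrier) λ h → IsPolynomial n c h × (∀ t → g t ≈ t * h t + d)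

  poly-isPolynomial : ∀ n a → IsPolynomial n (a n) (poly n a)
  poly-isPolynomial zero    a t = refl
  poly-isPolynomial (suc n) a =
    a 0 , poly n (λ p → a (suc p)) , poly-isPolynomial n (λ p → a (suc p)) , λ t → +-comm _ _

  remainder-theorem : ∀ n {c g} → IsPolynomial (suc n) c g → ∀ s →
    Σ (Carrier → Carrier) λ h → IsPolynomial n c h × (∀ t → g t ≈ (t - s) * h t + g s)
  remainder-theorem zero {c} {g} (d , h , h≈c , g≈th+d) s = (λ _ → c) , (λ _ → refl) , λ t → begin
    g t                         ≈⟨ g≈th+d t ⟩
    t * h t + d                 ≈⟨ +-congʳ (*-congˡ (h≈c t)) ⟩
    t * c + d                   ≈⟨ +-congʳ (sym ([x-y]z+yz≈xz t s c)) ⟩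
    (t - s) * c + s * c + d     ≈⟨ +-assoc _ _ _ ⟩
    (t - s) * c + (s * c + d)   ≈⟨ +-congˡ (sym (trans (g≈th+d s) (+-congʳ (*-congˡ (h≈c s))))) ⟩
    (t - s) * c + g s           ∎
  remainder-theorem (suc n) {c} {g} (d , h , h-poly , g≈th+d) s
    with remainder-theorem n h-poly s
  ... | k , k-poly , h≈[t-s]k+hs = (λ t → t * k t + h s) , (h s , k , k-poly , λ _ → refl) , λ t → begin
    g t
      ≈⟨ g≈th+d t ⟩
    t * h t + d
      ≈⟨ +-congʳ (*-congˡ (h≈[t-s]k+hs t)) ⟩
    t * ((t - s) * k t + h s) + d
      ≈⟨ solve 5 (λ t u k h d → t :* (u :* k :+ h) :+ d := u :* (t :* k) :+ t :* h :+ d) refl t (t - s) (k t) (h s) d ⟩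
    (t - s) * (t * k t) + t * h s + d
      ≈⟨ +-congʳ (+-congˡ (sym ([x-y]z+yz≈xz t s (h s)))) ⟩
    (t - s) * (t * k t) + ((t - s) * h s + s * h s) + d
      ≈⟨ solve 6 (λ t u k h d s → u :* (t :* k) :+ (u :* h :+ s :* h) :+ d := u :* (t :* k :+ h) :+ (s :* h :+ d))
                 refl t (t - s) (k t) (h s) d s ⟩
    (t - s) * (t * k t + h s) + (s * h s + d)
      ≈⟨ +-congˡ (sym (g≈th+d s)) ⟩
    (t - s) * (t * k t + h s) + g s ∎

  roots-factorization : ∀ n {c g} (x : Fin n → Carrier) → IsPolynomial n c g →
    (∀ i j → toℕ i <ℕ toℕ j → x i ≉ x j) → (∀ i → g (x i) ≈ 0#) →
    ∀ t → g t ≈ c * ∏ (λ i → t - x i)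
  roots-factorization zero    {c} x g≈c _ _ t = trans (g≈c t) (sym (*-identityʳ c))
  roots-factorization (suc n) {c} {g} x g-poly x-distinct gx≈0 t
    with remainder-theorem n g-poly (x Fin.zero)
  ... | h , h-poly , g≈[t-x₀]h+gx₀ = begin
    g t                          ≈⟨ g≈[t-x₀]h t ⟩
    (t - x₀) * h t               ≈⟨ *-congˡ (roots-factorization n (λ i → x (Fin.suc i)) h-poly
                                               (λ i j i<j → x-distinct (Fin.suc i) (Fin.suc j) (s≤s i<j)) hx≈0 t) ⟩
    (t - x₀) * (c * P)           ≈⟨ solve 3 (λ u c P → u :* (c :* P) := c :* (u :* P)) refl (t - x₀) c P ⟩
    c * ((t - x₀) * P)           ∎
    where
    x₀ = x Fin.zero
    P  = ∏ (λ i → t - x (Fin.suc i))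
    g≈[t-x₀]h : ∀ t → g t ≈ (t - x₀) * h t
    g≈[t-x₀]h t = trans (g≈[t-x₀]h+gx₀ t) (trans (+-congˡ (gx≈0 Fin.zero)) (+-identityʳ _))
    hx≈0 : ∀ i → h (x (Fin.suc i)) ≈ 0#
    hx≈0 i = x*y≈0⇒y≈0 xᵢ-x₀≉0 (trans (sym (g≈[t-x₀]h _)) (gx≈0 (Fin.suc i)))
      where
      xᵢ-x₀≉0 : x (Fin.suc i) - x₀ ≉ 0#
      xᵢ-x₀≉0 d≈0 = x-distinct Fin.zero (Fin.suc i) (s≤s z≤n) (sym (x∙y⁻¹≈ε⇒x≈y _ _ d≈0))

  -- The roots 1, …, n give g t ≈ c ∏ (t - i); as g also vanishes at n + 1, c ≈ 0.
  vanishing-off-0⇒vanishing : ∀ n {c g} → IsPolynomial n c g →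
                              (∀ z → z ≉ 0# → g z ≈ 0#) → ∀ z → g z ≈ 0#
  vanishing-off-0⇒vanishing n {c} {g} g-poly g≈0 z = begin
    g z                        ≈⟨ factorization z ⟩
    c * ∏ (λ i → z - point i)  ≈⟨ *-congʳ c≈0 ⟩
    0# * ∏ (λ i → z - point i) ≈⟨ zeroˡ _ ⟩
    0#                         ∎
    where
    point : Fin n → Carrier
    point i = fromℕ (suc (toℕ i))
    factorization : ∀ t → g t ≈ c * ∏ (λ i → t - point i)
    factorization = roots-factorization n point g-poly
      (λ i j i<j → fromℕ-≢ (λ 1+i≡1+j → ℕₚ.<-irrefl (ℕₚ.suc-injective 1+i≡1+j) i<j))
      (λ i → g≈0 (point i) (fromℕ-suc≉0 (toℕ i)))
    T-point≉0 : ∀ i → fromℕ (suc n) - point i ≉ 0#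
    T-point≉0 i d≈0 =
      fromℕ-≢ (λ 1+n≡1+i → ℕₚ.<-irrefl (≡.sym (ℕₚ.suc-injective 1+n≡1+i)) (toℕ<n i)) (x∙y⁻¹≈ε⇒x≈y _ _ d≈0)
    c≈0 : c ≈ 0#
    c≈0 = x*y≈0⇒y≈0 (∏≉0 _ T-point≉0)
            (trans (*-comm _ c) (trans (sym (factorization _)) (g≈0 _ (fromℕ-suc≉0 n))))

  poly≈0⇒coefficients≈0 : ∀ n a → (∀ z → poly n a z ≈ 0#) → ∀ p → p ≤ n → a p ≈ 0#
  poly≈0⇒coefficients≈0 n       a poly≈0 zero    _         = trans (sym (poly-at-0# n a)) (poly≈0 0#)
  poly≈0⇒coefficients≈0 (suc n) a poly≈0 (suc p) (s≤s p≤n) =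
    poly≈0⇒coefficients≈0 n a′ (vanishing-off-0⇒vanishing n (poly-isPolynomial n a′) a′≈0-off-0) p p≤n
    where
    a′ = λ p → a (suc p)
    a₀≈0 : a 0 ≈ 0#
    a₀≈0 = poly≈0⇒coefficients≈0 (suc n) a poly≈0 0 z≤n
    a′≈0-off-0 : ∀ z → z ≉ 0# → poly n a′ z ≈ 0#
    a′≈0-off-0 z z≉0 = x*y≈0⇒y≈0 z≉0 (trans (sym (trans (+-congʳ a₀≈0) (+-identityˡ _))) (poly≈0 z))

  poly-injective : ∀ n a b → (∀ z → poly n a z ≈ poly n b z) → ∀ p → p ≤ n → a p ≈ b p
  poly-injective n a b a≈b p p≤n = x∙y⁻¹≈ε⇒x≈y _ _ (poly≈0⇒coefficients≈0 n (λ q → a q - b q)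
    (λ z → trans (poly-minus n a b z) (trans (+-congʳ (a≈b z)) (-‿inverseʳ _))) p p≤n)

  esym-vanishes : ∀ n (u : Fin n → Carrier) p → n <ℕ p → esym n u p ≈ 0#
  esym-vanishes zero    u (suc p) _         = refl
  esym-vanishes (suc n) u (suc p) (s≤s n<p) = begin
    u Fin.zero * esym n u′ p + esym n u′ (suc p)
      ≈⟨ +-cong (*-congˡ (esym-vanishes n u′ p n<p)) (esym-vanishes n u′ (suc p) (ℕₚ.m<n⇒m<1+n n<p)) ⟩
    u Fin.zero * 0# + 0#   ≈⟨ trans (+-identityʳ _) (zeroʳ _) ⟩
    0#                     ∎
    where u′ = λ i → u (Fin.suc i)

  vieta : ∀ n (u : Fin n → Carrier) z → ∏ (λ i → 1# + u i * z) ≈ poly n (esym n u) z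
  vieta zero    u z = refl
  vieta (suc n) u z = begin
    (1# + u₀ * z) * ∏ (λ i → 1# + u′ i * z)
      ≈⟨ *-congˡ (vieta n u′ z) ⟩
    (1# + u₀ * z) * E
      ≈⟨ solve 3 (λ u z E → (con 1 :+ u :* z) :* E := E :+ u :* z :* E) refl u₀ z E ⟩
    E + u₀ * z * E
      ≈⟨ +-congʳ (sym (poly-truncate n (esym n u′) z (esym-vanishes n u′ (suc n) ℕₚ.≤-refl))) ⟩
    (1# + z * E′) + u₀ * z * E
      ≈⟨ solve 4 (λ z E′ u E → (con 1 :+ z :* E′) :+ u :* z :* E := con 1 :+ z :* (u :* E :+ E′)) refl z E′ u₀ E ⟩
    1# + z * (u₀ * E + E′)
      ≈⟨ +-congˡ (*-congˡ (sym (trans (poly-+ n _ _ z) (+-congʳ (poly-*ˡ n u₀ (esym n u′) z))))) ⟩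
    1# + z * poly n (λ p → u₀ * esym n u′ p + esym n u′ (suc p)) z ∎
    where
    u₀ = u Fin.zero
    u′ = λ i → u (Fin.suc i)
    E  = poly n (esym n u′) z
    E′ = poly n (λ p → esym n u′ (suc p)) z

  esym-reciprocals : ∀ n (c : ℕ → Carrier) (w : Fin n → Carrier) →
    (∀ z → poly n c z ≈ ∏ (λ i → z + w i)) → c 0 ≉ 0# →
    ∀ p → p ≤ n → c 0 * esym n (λ i → w i ⁻¹) p ≈ c p
  esym-reciprocals n c w c-factors c₀≉0 = poly-injective n _ c λ z → begin
    poly n (λ p → c 0 * e p) z     ≈⟨ poly-*ˡ n (c 0) e z ⟩
    c 0 * poly n e z               ≈⟨ *-cong c₀≈∏w (sym (vieta n u z)) ⟩
    ∏ w * ∏ (λ i → 1# + u i * z)   ≈⟨ ∏-distrib-* w (λ i → 1# + u i * z) ⟨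
    ∏ (λ i → w i * (1# + u i * z)) ≈⟨ ∏-cong (λ i → w[1+uz]≈z+w z i) ⟩
    ∏ (λ i → z + w i)              ≈⟨ c-factors z ⟨
    poly n c z                     ∎
    where
    u = λ i → w i ⁻¹
    e = esym n u
    c₀≈∏w : c 0 ≈ ∏ w
    c₀≈∏w = trans (sym (poly-at-0# n c)) (trans (c-factors 0#) (∏-cong (λ i → +-identityˡ (w i))))
    wᵢ≉0 : ∀ i → w i ≉ 0#
    wᵢ≉0 = ∏≉0⇒≉0 w (λ ∏w≈0 → c₀≉0 (trans c₀≈∏w ∏w≈0))
    w[1+uz]≈z+w : ∀ z i → w i * (1# + u i * z) ≈ z + w i
    w[1+uz]≈z+w z i = begin
      w i * (1# + u i * z)  ≈⟨ solve 3 (λ w u z → w :* (con 1 :+ u :* z) := (w :* u) :* z :+ w) refl (w i) (u i) z ⟩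
      (w i * u i) * z + w i ≈⟨ +-congʳ (*-congʳ (⁻¹-inverse (w i) (wᵢ≉0 i))) ⟩
      1# * z + w i          ≈⟨ +-congʳ (*-identityˡ z) ⟩
      z + w i               ∎

  -- The Eulerian polynomial at 1 + z

  sum1-cong : ∀ m {F G : ℕ → Carrier} → (∀ k → F k ≈ G k) → sum1 m F ≈ sum1 m G
  sum1-cong zero    F≈G = refl
  sum1-cong (suc m) F≈G = +-cong (sum1-cong m F≈G) (F≈G (suc m))

  sum1-∑ : {A : Set} (m : ℕ) (F : A → ℕ → Carrier) (xs : List A) →
           sum1 m (λ k → ∑ (λ x → F x k) xs) ≈ ∑ (λ x → sum1 m (F x)) xs
  sum1-∑ zero    F xs = sym (∑-zero xs)
  sum1-∑ (suc m) F xs = trans (+-congʳ (sum1-∑ m F xs)) (sym (∑-+ _ _ xs))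

  sum1-δ : ∀ t d m → suc d ≤ m → sum1 m (λ k → fromℕ (δ d (k ∸ 1)) * t ^ k) ≈ t ^ suc d
  sum1-δ t d (suc m) (s≤s d≤m) with d ℕ.≟ m
  ... | yes ≡.refl = begin
    sum1 d _ + fromℕ (δ d d) * t ^ suc d
      ≈⟨ +-cong (below d ℕₚ.≤-refl) (*-congʳ (reflexive (≡.cong fromℕ (δ-self d)))) ⟩
    0# + fromℕ 1 * t ^ suc d
      ≈⟨ trans (+-identityˡ _) (trans (*-congʳ fromℕ1≈1) (*-identityˡ _)) ⟩
    t ^ suc d ∎
    where
    below : ∀ m → m ≤ d → sum1 m (λ k → fromℕ (δ d (k ∸ 1)) * t ^ k) ≈ 0#
    below zero    _   = refl
    below (suc m) m<d = begin
      sum1 m _ + fromℕ (δ d m) * t ^ suc m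
        ≈⟨ +-cong (below m (ℕₚ.<⇒≤ m<d)) (*-congʳ (reflexive (≡.cong fromℕ (δ-≢ (ℕₚ.>⇒≢ m<d))))) ⟩
      0# + 0# * t ^ suc m
        ≈⟨ trans (+-identityˡ _) (zeroˡ _) ⟩
      0# ∎
  ... | no d≢m = begin
    sum1 m _ + fromℕ (δ d m) * t ^ suc m
      ≈⟨ +-cong (sum1-δ t d m (ℕₚ.≤∧≢⇒< d≤m d≢m)) (*-congʳ (reflexive (≡.cong fromℕ (δ-≢ d≢m)))) ⟩
    t ^ suc d + 0# * t ^ suc m
      ≈⟨ trans (+-congˡ (zeroˡ _)) (+-identityʳ _) ⟩
    t ^ suc d ∎

  eulerPoly-perms : ∀ n t → eulerPoly (suc n) t ≈ ∑ (λ σ → t ^ suc (descents σ)) (perms (suc n))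
  eulerPoly-perms n t = begin
    sum1 N (λ k → fromℕ (eulerian N k) * t ^ k)
      ≈⟨ sum1-cong N (λ k → *-congʳ (eulerian≈∑δ k)) ⟩
    sum1 N (λ k → ∑ (λ σ → fromℕ (δ (descents σ) (k ∸ 1))) (perms N) * t ^ k)
      ≈⟨ sum1-cong N (λ k → sym (∑-*ʳ _ _ (perms N))) ⟩
    sum1 N (λ k → ∑ (λ σ → fromℕ (δ (descents σ) (k ∸ 1)) * t ^ k) (perms N))
      ≈⟨ sum1-∑ N (λ σ k → fromℕ (δ (descents σ) (k ∸ 1)) * t ^ k) (perms N) ⟩
    ∑ (λ σ → sum1 N (λ k → fromℕ (δ (descents σ) (k ∸ 1)) * t ^ k)) (perms N)
      ≈⟨ ∑-cong (perms N) (All.map (λ {σ} σ-word → sum1-δ t (descents σ) N (descents<length σ-word))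
                                   (perms-Word N)) ⟩
    ∑ (λ σ → t ^ suc (descents σ)) (perms N) ∎
    where
    N = suc n
    eulerian≈∑δ : ∀ k → fromℕ (eulerian N k) ≈ ∑ (λ σ → fromℕ (δ (descents σ) (k ∸ 1))) (perms N)
    eulerian≈∑δ k = trans (reflexive (≡.cong fromℕ (length-filter≡∑δ descents (k ∸ 1) (perms N))))
                          (fromℕ-∑ (λ σ → δ (descents σ) (k ∸ 1)) (perms N))

  binomial-theorem : ∀ {t z} → t ≈ 1# + z → ∀ m n → m ≤ n → t ^ m ≈ poly n (λ p → fromℕ (m C p)) z
  binomial-theorem {t} {z} t≈1+z zero n _ = sym (constant n)
    where
    constant : ∀ n → poly n (λ p → fromℕ (0 C p)) z ≈ 1#
    constant zero    = fromℕ1≈1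
    constant (suc n) =
      trans (+-congˡ (trans (*-congˡ (poly-0# n z)) (zeroʳ z))) (trans (+-identityʳ _) fromℕ1≈1)
  binomial-theorem {t} {z} t≈1+z (suc m) (suc n) (s≤s m≤n) = begin
    t * t ^ m
      ≈⟨ *-cong t≈1+z (binomial-theorem t≈1+z m n m≤n) ⟩
    (1# + z) * P
      ≈⟨ solve 2 (λ z P → (con 1 :+ z) :* P := P :+ z :* P) refl z P ⟩
    P + z * P
      ≈⟨ +-congʳ (sym (poly-truncate n (λ p → fromℕ (m C p)) z m-choose-1+n≈0)) ⟩
    (fromℕ (m C 0) + z * P′) + z * P
      ≈⟨ +-congʳ (+-congʳ (mC0≈1 m)) ⟩
    (1# + z * P′) + z * P
      ≈⟨ solve 3 (λ z P′ P → (con 1 :+ z :* P′) :+ z :* P := con 1 :+ z :* (P :+ P′)) refl z P′ P ⟩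
    1# + z * (P + P′)
      ≈⟨ +-cong (sym (mC0≈1 (suc m))) (*-congˡ (sym (trans (poly-cong n z pascal-fromℕ) (poly-+ n _ _ z)))) ⟩
    fromℕ (suc m C 0) + z * poly n (λ p → fromℕ (suc m C suc p)) z ∎
    where
    mC0≈1 : ∀ m → fromℕ (m C 0) ≈ 1#
    mC0≈1 m = trans (reflexive (≡.cong fromℕ (nC0≡1 m))) fromℕ1≈1
    P  = poly n (λ p → fromℕ (m C p)) z
    P′ = poly n (λ p → fromℕ (m C suc p)) z
    m-choose-1+n≈0 : fromℕ (m C suc n) ≈ 0#
    m-choose-1+n≈0 = reflexive (≡.cong fromℕ (k>n⇒nCk≡0 (s≤s m≤n)))
    pascal-fromℕ : ∀ p → fromℕ (suc m C suc p) ≈ fromℕ (m C p) + fromℕ (m C suc p)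
    pascal-fromℕ p = trans (reflexive (≡.cong fromℕ (≡.sym (pascal m p)))) (fromℕ-+ (m C p) (m C suc p))

  eulerPoly-taylor : ∀ n {t z} → t ≈ 1# + z →
    eulerPoly (suc n) t ≈ poly (suc n) (λ q → fromℕ (taylorCoeff (suc n) q)) z
  eulerPoly-taylor n {t} {z} t≈1+z = begin
    eulerPoly N t
      ≈⟨ eulerPoly-perms n t ⟩
    ∑ (λ σ → t ^ suc (descents σ)) (perms N)
      ≈⟨ ∑-cong (perms N) (All.map (λ σ-word → binomial-theorem t≈1+z _ N (descents<length σ-word)) (perms-Word N)) ⟩
    ∑ (λ σ → poly N (λ q → fromℕ (suc (descents σ) C q)) z) (perms N)
      ≈⟨ poly-∑ N (λ σ q → fromℕ (suc (descents σ) C q)) z (perms N) ⟩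
    poly N (λ q → ∑ (λ σ → fromℕ (suc (descents σ) C q)) (perms N)) z
      ≈⟨ poly-cong N z (λ q → sym (fromℕ-∑ (λ σ → suc (descents σ) C q) (perms N))) ⟩
    poly N (λ q → fromℕ (taylorCoeff N q)) z ∎
    where N = suc n

  taylorPoly-factorization : ∀ n (x : Fin (suc n) → Carrier) →
    (∀ i j → toℕ i <ℕ toℕ j → x i < x j) → (∀ i → eulerPoly (suc n) (x i) ≈ 0#) →
    ∀ z → poly (suc n) (λ q → fromℕ (taylorCoeff (suc n) q)) z ≈ ∏ (λ i → z + (1# - x i))
  taylorPoly-factorization n x x-increasing x-roots z = begin
    poly N c z               ≈⟨ roots-factorization N y (poly-isPolynomial N c) y-distinct y-roots z ⟩
    c N * ∏ (λ i → z - y i)  ≈⟨ *-congʳ (trans (reflexive (≡.cong fromℕ (taylorCoeff-top N))) fromℕ1≈1) ⟩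
    1# * ∏ (λ i → z - y i)   ≈⟨ *-identityˡ _ ⟩
    ∏ (λ i → z - y i)        ≈⟨ ∏-cong (λ i → +-congˡ {z} (⁻¹-involutive (1# - x i))) ⟩
    ∏ (λ i → z + (1# - x i)) ∎
    where
    N = suc n
    c = λ q → fromℕ (taylorCoeff N q)
    y : Fin N → Carrier
    y i = - (1# - x i)
    x≈1+y : ∀ i → x i ≈ 1# + y i
    x≈1+y i = begin
      x i              ≈⟨ sym (x-y+y≈x (x i) 1#) ⟩
      (x i - 1#) + 1#  ≈⟨ +-comm _ _ ⟩
      1# + (x i - 1#)  ≈⟨ +-congˡ (sym (⁻¹-anti-homo‿- 1# (x i))) ⟩
      1# + y i         ∎
    y-roots : ∀ i → poly N c (y i) ≈ 0#
    y-roots i = trans (sym (eulerPoly-taylor n (x≈1+y i))) (x-roots i)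
    y-distinct : ∀ i j → toℕ i <ℕ toℕ j → y i ≉ y j
    y-distinct i j i<j yᵢ≈yⱼ =
      <⇒≉ (x-increasing i j i<j) (trans (x≈1+y i) (trans (+-congˡ yᵢ≈yⱼ) (sym (x≈1+y j))))

open Combinatorics using (taylorCoeff; taylorCoeff-zero; taylorCoeff-stirling2)

lemma3 : (R : RealField) → let open RealOps R in
    (n : ℕ) → 1 ≤ n →
    (x : Fin n → Carrier) →
    (∀ i j → toℕ i <ℕ toℕ j → x i < x j) →
    (∀ i → eulerPoly n (x i) ≈ 0#) →
    (p : ℕ) → p ≤ n →
    esym n (λ i → (1# - x i) ⁻¹) p
      ≈ (fromℕ ((n ∸ p) !) * (fromℕ (n !) ⁻¹)) * fromℕ (stirling2 (suc n) (suc (n ∸ p)))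
lemma3 R (suc n) _ x x-increasing x-roots p p≤N = begin
  esym N u p      ≈⟨ x≉0∧xy≈z⇒y≈zx⁻¹ N!≉0 N!·eₚ≈cₚ ⟩
  c p * N! ⁻¹     ≈⟨ *-congʳ cₚ≈A·S ⟩
  (A * S) * N! ⁻¹ ≈⟨ solve 3 (λ A S N!⁻¹ → (A :* S) :* N!⁻¹ := (A :* N!⁻¹) :* S) refl A S (N! ⁻¹) ⟩
  (A * N! ⁻¹) * S ∎
  where
  open RealOps R
  open Reals R
  open import Relation.Binary.Reasoning.Setoid setoid
  open import Algebra.Solver.Ring.NaturalCoefficients.Default commutativeSemiring using (solve; _:=_; _:*_)
  N  = suc n
  u  = λ i → (1# - x i) ⁻¹
  c  = λ q → fromℕ (taylorCoeff N q)
  N! = fromℕ (N !)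
  A  = fromℕ ((N ∸ p) !)
  S  = fromℕ (stirling2 (suc N) (suc (N ∸ p)))
  N!≉0 : N! ≉ 0#
  N!≉0 = fromℕ-≢ (≢-nonZero⁻¹ (N !) {{N !≢0}})
  c₀≡N! : c 0 ≡ N!
  c₀≡N! = ≡.cong fromℕ (taylorCoeff-zero N)
  N!·eₚ≈cₚ : N! * esym N u p ≈ c p
  N!·eₚ≈cₚ = ≡.subst (λ a → a * esym N u p ≈ c p) c₀≡N!
    (esym-reciprocals N c (λ i → 1# - x i) (taylorPoly-factorization n x x-increasing x-roots)
      (≡.subst (_≉ 0#) (≡.sym c₀≡N!) N!≉0) p p≤N)
  cₚ≈A·S : c p ≈ A * S
  cₚ≈A·S = trans (reflexive (≡.cong fromℕ (taylorCoeff-stirling2 N (N ∸ p) p (m∸n+n≡m p≤N))))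
                 (fromℕ-* ((N ∸ p) !) (stirling2 (suc N) (suc (N ∸ p))))
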